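{- Let $\mathcal{A}$ be a finite alphabet and let $s$ be a balanced standard episturmian sequence over $\mathcal{A}$ containing at least three distinct letters. Suppose a directive sequence of $s$ is $\Delta(s)=a^{\ell}z$ with $a\in\mathcal{A}$, $\ell\ge2$, $z\in\mathcal{A}^{\omega}$ and $z_1\ne a$. Then there exist $m\ge 2$ and pairwise distinct letters $a_1=a,a_2,\dots,a_m$ such that $\Delta(s)=a_1^{\ell}\,a_2a_3\cdots a_{m-1}\,a_m^{\omega}$ (i.e. up to renaming, $\Delta(s)=1^{\ell}23\cdots(k-1)k^{\omega}$).
   Context: For a finite word $w$, $w^{(+)}$ denotes the shortest palindrome having $w$ as a prefix. For an infinite word $\Delta=x_1x_2\cdots$ set $u_1=\varepsilon$, $u_{n+1}=(u_nx_n)^{(+)}$. An infinite word $s$ is standard episturmian if there exists an infinite word $\Delta$ (a directive sequence of $s$) such that every $u_n$ is a prefix of $s$. A word is balanced if for any two factors $u,v$ of the same length and every letter $b$, $||u|_b-|v|_b|\le1$, where $|u|_b$ counts occurrences of $b$ in $u$. -}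

module Defs where

open import Data.Nat using (ℕ; zero; suc; _+_; _≤_; _<_)
open import Data.Fin using (Fin; zero; suc)
open import Data.Fin.Properties using () renaming (_≟_ to _≟F_)
open import Data.List using (List; []; _∷_; _++_; [_]; length; reverse; filter)
open import Data.Product using (Σ; ∃; _×_; _,_)
open import Relation.Binary.PropositionalEquality using (_≡_; _≢_)
open import Relation.Nullary using (¬_)

Letter : ℕ → Set
Letter k = Fin k

Word : ℕ → Set
Word k = List (Fin k)

InfWord : ℕ → Set
InfWord k = ℕ → Fin k

IsPrefix : ∀ {k} → Word k → Word k → Set
IsPrefix w p = Σ (Word _) λ r → w ++ r ≡ p

IsPalindrome : ∀ {k} → Word k → Set
IsPalindrome w = reverse w ≡ w

IsPalClosure : ∀ {k} → Word k → Word k → Set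
IsPalClosure w p =
  IsPalindrome p × IsPrefix w p ×
  (∀ q → IsPalindrome q → IsPrefix w q → length p ≤ length q)

takeω : ∀ {k} → ℕ → InfWord k → Word k
takeω zero    s = []
takeω (suc n) s = s 0 ∷ takeω n (λ i → s (suc i))

factor : ∀ {k} → InfWord k → ℕ → ℕ → Word k
factor s i n = takeω n (λ j → s (i + j))

IsPrefixω : ∀ {k} → Word k → InfWord k → Set
IsPrefixω w s = takeω (length w) s ≡ w

IsDirective : ∀ {k} → InfWord k → InfWord k → Set
IsDirective {k} Δ s =
  Σ (ℕ → Word k) λ u →
    (u 0 ≡ []) ×
    (∀ n → IsPalClosure (u n ++ [ Δ n ]) (u (suc n))) ×
    (∀ n → IsPrefixω (u n) s)

IsStandardEpisturmian : ∀ {k} → InfWord k → Set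
IsStandardEpisturmian {k} s = Σ (InfWord k) λ Δ → IsDirective Δ s

count : ∀ {k} → Fin k → Word k → ℕ
count b w = length (filter (λ c → c ≟F b) w)

-- Balanced: for factors u, v of equal length and any letter b, ||u|_b - |v|_b| ≤ 1
-- (stated as |u|_b ≤ 1 + |v|_b for all ordered pairs, which is the absolute-value bound).
IsBalanced : ∀ {k} → InfWord k → Set
IsBalanced s = ∀ i j n b → count b (factor s i n) ≤ suc (count b (factor s j n))

HasThreeLetters : ∀ {k} → InfWord k → Set
HasThreeLetters s = ∃ λ i → ∃ λ j → ∃ λ l →
  (s i ≢ s j) × (s i ≢ s l) × (s j ≢ s l)

clamp : ∀ n → ℕ → Fin (suc n)
clamp zero    _       = zero
clamp (suc n) zero    = zero
clamp (suc n) (suc t) = suc (clamp n t)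

-- The palindromic prefixes u n are computed explicitly. Write b i = Δ (ℓ + i). As long as
-- a, b 0, …, b m are pairwise distinct, u (ℓ + m) = Q m where Q 0 = a^ℓ and
-- Q (j + 1) = Q j · b j · Q j. By pigeonhole some b m is not new, and every way this can happen
-- other than b m = b (m − 1) yields factors x A x and B d B of s with |x A x| ≤ |B d B| and
-- x ∉ B d B, contradicting balance:
--   b m = a             gives  e a^(ℓ+1) e  (e = Δ ℓ)  against  a^ℓ d a^ℓ  (d a third letter);
--   b m = b j, j+1 < m  gives  b j · Q j · b j  against  Q j · b (j+1) · Q j.
-- Once b (n + 1) = b n = c, the prefixes are Q n (c Q n)^r, and the same two arguments, together
-- with  c · Q n · c  against  Q n · x · Q n  for a letter x not seen before, force every later
-- letter to be c.

module Submission where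

open import Data.Nat using (ℕ; zero; suc; pred; _+_; _∸_; _≤_; _<_; _⊓_; z≤n; s≤s)
open import Data.Nat.Properties
  using (≤-refl; ≤-reflexive; ≤-trans; ≤-antisym; ≤-total; ≤-pred; <⇒≤; <-irrefl; <-cmp;
         ≰⇒>; _≤?_; n≤1+n; n<1+n; 1+n≰n; m≤n⇒m<n∨m≡n; m∸n+n≡m;
         m≤n⇒m⊓n≡m; m≥n⇒m⊓n≡n;
         +-assoc; +-comm; +-suc; +-identityʳ; +-monoʳ-≤; +-monoˡ-≤; +-cancelˡ-≤; +-cancelˡ-≡; anyUpTo?)
open import Data.Fin using (Fin; zero; suc; toℕ)
open import Data.Fin.Properties using (toℕ<n; toℕ-injective; pigeonhole) renaming (_≟_ to _≟F_)
open import Data.List using (List; []; _∷_; _++_; [_]; length; reverse; replicate; take; drop)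
open import Data.List.Properties
  using (∷-injective; ∷-injectiveˡ; ++-assoc; ++-identityʳ; ++-cancelʳ; ++-conicalʳ;
         length-++; length-++-≤ˡ; length-++-≤ʳ;
         length-reverse; length-replicate; length-take; take++drop≡id; reverse-++; reverse-involutive;
         reverse-injective; unfold-reverse; filter-accept; filter-some; filter-none)
open import Data.List.Relation.Unary.All using (All; []; _∷_)
import Data.List.Relation.Unary.All.Properties as All
open import Data.List.Relation.Unary.Any using (here)
import Data.List.Relation.Unary.Any.Properties as Any
open import Data.Product using (Σ; _×_; _,_; proj₁; proj₂)
import Data.Product as Product
open import Data.Sum using (_⊎_; inj₁; inj₂; swap)
open import Data.Empty using (⊥; ⊥-elim)
open import Function.Definitions using (Injective)
open import Relation.Binary using (tri<; tri≈; tri>)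
open import Relation.Binary.PropositionalEquality hiding ([_])
open import Relation.Nullary using (¬_; yes; no)
open import Relation.Nullary.Decidable using (toSum)

open import Defs

-- Equations between concatenations

module _ {A : Set} where

  ++-∷-split : ∀ (l m xs : List A) y ys → l ++ m ≡ xs ++ y ∷ ys →
               (Σ (List A) λ t → xs ≡ l ++ t × m ≡ t ++ y ∷ ys) ⊎
               (Σ (List A) λ t → l ≡ xs ++ y ∷ t × ys ≡ t ++ m)
  ++-∷-split []      m xs       y ys eq = inj₁ (xs , refl , eq)
  ++-∷-split (x ∷ l) m []       y ys eq with ∷-injective eq
  ... | refl , eq′ = inj₂ (l , refl , sym eq′)
  ++-∷-split (x ∷ l) m (_ ∷ xs) y ys eq with ∷-injective eq
  ... | refl , eq′ with ++-∷-split l m xs y ys eq′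
  ...   | inj₁ (t , xs≡ , m≡)  = inj₁ (t , cong (x ∷_) xs≡ , m≡)
  ...   | inj₂ (t , l≡ , ys≡)  = inj₂ (t , cong (x ∷_) l≡ , ys≡)

  ++-split-≤ : ∀ (xs ys zs ws : List A) → xs ++ ys ≡ zs ++ ws → length xs ≤ length zs →
               Σ (List A) λ t → zs ≡ xs ++ t × ys ≡ t ++ ws
  ++-split-≤ []       ys zs       ws eq _        = zs , refl , eq
  ++-split-≤ (x ∷ xs) ys (_ ∷ zs) ws eq (s≤s le) with ∷-injective eq
  ... | refl , eq′ = Product.map₂ (Product.map₁ (cong (x ∷_))) (++-split-≤ xs ys zs ws eq′ le)

  ++-cancel-length : ∀ (xs ys zs ws : List A) → xs ++ ys ≡ zs ++ ws → length xs ≡ length zs →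
                     xs ≡ zs × ys ≡ ws
  ++-cancel-length []       ys []       ws eq _ = refl , eq
  ++-cancel-length (x ∷ xs) ys (_ ∷ zs) ws eq l≡ with ∷-injective eq
  ... | refl , eq′ = Product.map₁ (cong (x ∷_)) (++-cancel-length xs ys zs ws eq′ (cong pred l≡))

  replicate-prefix : ∀ n {a y : A} (xs ys zs : List A) → y ≢ a →
                     xs ++ y ∷ ys ≡ replicate n a ++ zs → Σ (List A) λ t → xs ≡ replicate n a ++ t
  replicate-prefix zero    xs       ys zs _   _  = xs , refl
  replicate-prefix (suc n) []       ys zs y≢a eq = ⊥-elim (y≢a (∷-injectiveˡ eq))
  replicate-prefix (suc n) (x ∷ xs) ys zs y≢a eq with ∷-injective eq
  ... | refl , eq′ = Product.map₂ (cong (x ∷_)) (replicate-prefix n xs ys zs y≢a eq′)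

  replicate-snoc : ∀ n (a : A) → replicate n a ++ [ a ] ≡ a ∷ replicate n a
  replicate-snoc zero    a = refl
  replicate-snoc (suc n) a = cong (a ∷_) (replicate-snoc n a)

  reverse-replicate : ∀ n (a : A) → reverse (replicate n a) ≡ replicate n a
  reverse-replicate zero    a = refl
  reverse-replicate (suc n) a = begin
    reverse (a ∷ replicate n a)     ≡⟨ unfold-reverse a (replicate n a) ⟩
    reverse (replicate n a) ++ [ a ] ≡⟨ cong (_++ [ a ]) (reverse-replicate n a) ⟩
    replicate n a ++ [ a ]           ≡⟨ replicate-snoc n a ⟩
    a ∷ replicate n a                ∎
    where open ≡-Reasoning

  All-reverse : ∀ {P : A → Set} {xs} → All P xs → All P (reverse xs)
  All-reverse {xs = []}     []         = []
  All-reverse {xs = x ∷ xs} (px ∷ pxs) =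
    subst (All _) (sym (unfold-reverse x xs)) (All.∷ʳ⁺ (All-reverse pxs) px)

-- Palindromes and palindromic closure

module _ {k : ℕ} where

  prefix-refl : ∀ (w : Word k) → IsPrefix w w
  prefix-refl w = [] , ++-identityʳ w

  prefix-trans : ∀ {w v x : Word k} → IsPrefix w v → IsPrefix v x → IsPrefix w x
  prefix-trans {w} (r , refl) (r′ , refl) = r ++ r′ , sym (++-assoc w r r′)

  prefix-chain : (f : ℕ → Word k) → (∀ i → IsPrefix (f i) (f (suc i))) →
                 ∀ {i j} → i ≤ j → IsPrefix (f i) (f j)
  prefix-chain f step {j = zero}  z≤n = prefix-refl (f zero)
  prefix-chain f step {j = suc j} i≤1+j with m≤n⇒m<n∨m≡n i≤1+j
  ... | inj₁ i<1+j = prefix-trans (prefix-chain f step (≤-pred i<1+j)) (step j)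
  ... | inj₂ refl  = prefix-refl (f (suc j))

  IsInfix : Word k → Word k → Set
  IsInfix F w = Σ (Word k) λ l → Σ (Word k) λ r → l ++ F ++ r ≡ w

  infix-length : ∀ {F w : Word k} → IsInfix F w → length F ≤ length w
  infix-length {F} (l , r , refl) = ≤-trans (length-++-≤ˡ F) (length-++-≤ʳ (F ++ r) {l})

  infix-++-∷ : ∀ {F x v : Word k} {y} → All (_≢ y) F → IsInfix F (x ++ y ∷ v) →
               IsInfix F x ⊎ IsInfix F v
  infix-++-∷ {F} {x} {v} {y} y∉F (l , r , eq) with ++-∷-split l (F ++ r) x y v eq
  ... | inj₂ (t , _ , v≡) = inj₂ (t , r , sym v≡)
  ... | inj₁ (t , x≡ , Fr≡) with ++-∷-split F r t y v Fr≡
  ...   | inj₁ (t′ , t≡ , _) = inj₁ (l , t′ , sym (trans x≡ (cong (l ++_) t≡)))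
  ...   | inj₂ (t′ , F≡ , _) with All.++⁻ʳ t (subst (All (_≢ y)) F≡ y∉F)
  ...     | y≢y ∷ _ = ⊥-elim (y≢y refl)

  palindrome-sandwich : ∀ (z y : Word k) → IsPalindrome y → IsPalindrome (z ++ y ++ reverse z)
  palindrome-sandwich z y y-pal = begin
    reverse (z ++ y ++ reverse z)                   ≡⟨ reverse-++ z (y ++ reverse z) ⟩
    reverse (y ++ reverse z) ++ reverse z           ≡⟨ cong (_++ reverse z) (reverse-++ y (reverse z)) ⟩
    (reverse (reverse z) ++ reverse y) ++ reverse z
      ≡⟨ cong₂ (λ p q → (p ++ q) ++ reverse z) (reverse-involutive z) y-pal ⟩
    (z ++ y) ++ reverse z                           ≡⟨ ++-assoc z y (reverse z) ⟩
    z ++ y ++ reverse z                             ∎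
    where open ≡-Reasoning

  palindrome-ends : ∀ h (v : Word k) x → IsPalindrome (h ∷ v ++ [ x ]) → h ≡ x
  palindrome-ends h v x pal = sym (∷-injectiveˡ (trans (sym (reverse-++ (h ∷ v) [ x ])) pal))

  palindrome-split : ∀ (w t : Word k) → IsPalindrome (w ++ t) → length t ≤ length w →
                     Σ (Word k) λ D → w ≡ reverse t ++ D × IsPalindrome D
  palindrome-split w t pal t≤w with ++-split-≤ (reverse t) (reverse w) w t
                                       (trans (sym (reverse-++ w t)) pal)
                                       (subst (_≤ length w) (sym (length-reverse t)) t≤w)
  ... | D , w≡ , rev-w≡ = D , w≡ , ++-cancelʳ t (reverse D) D (begin
    reverse D ++ t                     ≡⟨ cong (reverse D ++_) (reverse-involutive t) ⟨
    reverse D ++ reverse (reverse t)   ≡⟨ reverse-++ (reverse t) D ⟨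
    reverse (reverse t ++ D)           ≡⟨ cong reverse w≡ ⟨
    reverse w                          ≡⟨ rev-w≡ ⟩
    D ++ t                             ∎)
    where open ≡-Reasoning

  palindrome-prefix⇒suffix : ∀ {w p : Word k} → IsPalindrome w → IsPrefix p w →
                             Σ (Word k) λ P → w ≡ P ++ reverse p
  palindrome-prefix⇒suffix {w} {p} pal (r , refl) = reverse r , trans (sym pal) (reverse-++ p r)

  palClosure-self : ∀ {w : Word k} → IsPalindrome w → IsPalClosure w w
  palClosure-self {w} pal = pal , prefix-refl w , λ { q _ (r , refl) → length-++-≤ˡ w }

  palClosure-ext : ∀ {w p : Word k} → IsPalClosure w p →
                   Σ (Word k) λ t → w ++ t ≡ p × length t ≤ length w
  palClosure-ext {w} (_ , (t , refl) , minimal) = t , refl , +-cancelˡ-≤ (length w) (length t) (length w) (begin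
    length w + length t           ≡⟨ length-++ w ⟨
    length (w ++ t)               ≤⟨ minimal (w ++ reverse w) (palindrome-sandwich w [] refl)
                                             (reverse w , refl) ⟩
    length (w ++ reverse w)       ≡⟨ length-++ w ⟩
    length w + length (reverse w) ≡⟨ cong (length w +_) (length-reverse w) ⟩
    length w + length w           ∎)
    where open Data.Nat.Properties.≤-Reasoning

  palClosure-unique : ∀ {w p q : Word k} → IsPalClosure w p → IsPalClosure w q → p ≡ q
  palClosure-unique {w} cp@(p-pal , _ , p-min) cq@(q-pal , _ , q-min)
    with palClosure-ext cp | palClosure-ext cq
  ... | t , refl , t≤w | t′ , refl , t′≤w
    with palindrome-split w t p-pal t≤w | palindrome-split w t′ q-pal t′≤w
  ... | D , w≡ , _ | D′ , w≡′ , _ = cong (w ++_) (reverse-injective rev-t≡)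
    where
    same-length : length t ≡ length t′
    same-length = +-cancelˡ-≡ (length w) (length t) (length t′) (begin
      length w + length t  ≡⟨ length-++ w ⟨
      length (w ++ t)      ≡⟨ ≤-antisym (p-min (w ++ t′) q-pal (t′ , refl))
                                        (q-min (w ++ t) p-pal (t , refl)) ⟩
      length (w ++ t′)     ≡⟨ length-++ w ⟩
      length w + length t′ ∎)
      where open ≡-Reasoning
    rev-t≡ : reverse t ≡ reverse t′
    rev-t≡ = proj₁ (++-cancel-length (reverse t) D (reverse t′) D′ (trans (sym w≡) w≡′)
                     (trans (length-reverse t) (trans same-length (sym (length-reverse t′)))))

  palClosure-All : ∀ {P : Fin k → Set} {w p : Word k} → IsPalClosure w p → All P w → All P p
  palClosure-All {P} {w} cp w-all with palClosure-ext cp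
  ... | t , refl , t≤w with palindrome-split w t (proj₁ cp) t≤w
  ... | D , w≡ , _ = All.++⁺ w-all (subst (All P) (reverse-involutive t)
                       (All-reverse (All.++⁻ˡ (reverse t) (subst (All P) w≡ w-all))))

  palClosure-intro : ∀ (z y : Word k) → IsPalindrome y →
                     (∀ z₁ h z₂ → z ≡ z₁ ++ h ∷ z₂ → ¬ IsPalindrome (h ∷ z₂ ++ y)) →
                     IsPalClosure (z ++ y) (z ++ y ++ reverse z)
  palClosure-intro z y y-pal no-longer =
    palindrome-sandwich z y y-pal , (reverse z , ++-assoc z y (reverse z)) , minimal
    where
    no-shorter : ∀ t → IsPalindrome ((z ++ y) ++ t) → length t < length z → ⊥
    no-shorter t pal t<z with palindrome-split (z ++ y) t pal (≤-trans (<⇒≤ t<z) (length-++-≤ˡ z))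
    ... | D , zy≡ , D-pal
      with ++-split-≤ (reverse t) D z y (sym zy≡) (subst (_≤ length z) (sym (length-reverse t)) (<⇒≤ t<z))
    ... | [] , z≡ , _ =
      <-irrefl (trans (sym (length-reverse t)) (cong length (sym (trans z≡ (++-identityʳ _))))) t<z
    ... | h ∷ z₂ , z≡ , D≡ = no-longer (reverse t) h z₂ z≡ (subst IsPalindrome D≡ D-pal)
    minimal : ∀ q → IsPalindrome q → IsPrefix (z ++ y) q → length (z ++ y ++ reverse z) ≤ length q
    minimal q q-pal (t , refl) with length z ≤? length t
    ... | yes z≤t = begin
      length (z ++ y ++ reverse z)         ≡⟨ cong length (++-assoc z y (reverse z)) ⟨
      length ((z ++ y) ++ reverse z)       ≡⟨ length-++ (z ++ y) ⟩
      length (z ++ y) + length (reverse z) ≡⟨ cong (length (z ++ y) +_) (length-reverse z) ⟩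
      length (z ++ y) + length z           ≤⟨ +-monoʳ-≤ (length (z ++ y)) z≤t ⟩
      length (z ++ y) + length t           ≡⟨ length-++ (z ++ y) ⟨
      length ((z ++ y) ++ t)               ∎
      where open Data.Nat.Properties.≤-Reasoning
    ... | no z≰t = ⊥-elim (no-shorter t q-pal (≰⇒> z≰t))

  palClosure-fresh : ∀ (z y : Word k) x → IsPalindrome (y ++ [ x ]) → All (_≢ x) z →
                     IsPalClosure (z ++ y ++ [ x ]) (z ++ (y ++ [ x ]) ++ reverse z)
  palClosure-fresh z y x pal x∉z = palClosure-intro z (y ++ [ x ]) pal no-longer
    where
    no-longer : ∀ z₁ h z₂ → z ≡ z₁ ++ h ∷ z₂ → ¬ IsPalindrome (h ∷ z₂ ++ y ++ [ x ])
    no-longer z₁ h z₂ refl longer-pal with All.++⁻ʳ z₁ x∉z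
    ... | h≢x ∷ _ = h≢x (palindrome-ends h (z₂ ++ y) x
                      (subst (λ v → IsPalindrome (h ∷ v)) (sym (++-assoc z₂ y [ x ])) longer-pal))

  palClosure-run : ∀ (P : Word k) {e a} ℓ → e ≢ a →
                   ¬ IsInfix (replicate (suc ℓ) a) (P ++ e ∷ replicate ℓ a) →
                   IsPalClosure ((P ++ [ e ]) ++ replicate (suc ℓ) a)
                                ((P ++ [ e ]) ++ replicate (suc ℓ) a ++ reverse (P ++ [ e ]))
  palClosure-run P {e} {a} ℓ e≢a no-run =
    palClosure-intro (P ++ [ e ]) A (reverse-replicate (suc ℓ) a) no-longer
    where
    A = replicate (suc ℓ) a
    no-longer : ∀ z₁ h z₂ → P ++ [ e ] ≡ z₁ ++ h ∷ z₂ → ¬ IsPalindrome (h ∷ z₂ ++ A)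
    no-longer z₁ h z₂ eq pal with ++-∷-split z₁ (h ∷ z₂) P e [] (sym eq)
    ... | inj₂ (t , _ , []≡) with ++-conicalʳ t (h ∷ z₂) (sym []≡)
    ...   | ()
    no-longer z₁ h z₂ eq pal | inj₁ (t , refl , hz₂≡)
      with replicate-prefix (suc ℓ) t A (e ∷ reverse t) e≢a (begin
      t ++ e ∷ A                    ≡⟨ ++-assoc t [ e ] A ⟨
      (t ++ [ e ]) ++ A             ≡⟨ subst (λ v → IsPalindrome (v ++ A)) hz₂≡ pal ⟨
      reverse ((t ++ [ e ]) ++ A)   ≡⟨ reverse-++ (t ++ [ e ]) A ⟩
      reverse A ++ reverse (t ++ [ e ]) ≡⟨ cong₂ _++_ (reverse-replicate (suc ℓ) a) (reverse-++ t [ e ]) ⟩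
      A ++ e ∷ reverse t            ∎)
      where open ≡-Reasoning
    ... | t′ , refl = no-run (z₁ , t′ ++ e ∷ replicate ℓ a , (begin
      z₁ ++ A ++ t′ ++ e ∷ replicate ℓ a    ≡⟨ cong (z₁ ++_) (++-assoc A t′ _) ⟨
      z₁ ++ (A ++ t′) ++ e ∷ replicate ℓ a  ≡⟨ ++-assoc z₁ (A ++ t′) _ ⟨
      (z₁ ++ A ++ t′) ++ e ∷ replicate ℓ a  ∎))
      where open ≡-Reasoning

-- Factors of infinite words and balance

module _ {k : ℕ} where

  length-takeω : ∀ n (f : InfWord k) → length (takeω n f) ≡ n
  length-takeω zero    f = refl
  length-takeω (suc n) f = cong suc (length-takeω n (λ i → f (suc i)))

  takeω-cong : ∀ n {f g : InfWord k} → (∀ i → f i ≡ g i) → takeω n f ≡ takeω n g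
  takeω-cong zero    f≗g = refl
  takeω-cong (suc n) f≗g = cong₂ _∷_ (f≗g 0) (takeω-cong n (λ i → f≗g (suc i)))

  takeω-+ : ∀ m n (f : InfWord k) → takeω (m + n) f ≡ takeω m f ++ takeω n (λ i → f (m + i))
  takeω-+ zero    n f = refl
  takeω-+ (suc m) n f = cong (f 0 ∷_) (takeω-+ m n (λ i → f (suc i)))

  factor-++⁻ : ∀ (s : InfWord k) i (F G : Word k) → factor s i (length (F ++ G)) ≡ F ++ G →
               factor s i (length F) ≡ F × factor s (i + length F) (length G) ≡ G
  factor-++⁻ s i F G eq with ++-cancel-length _ _ F G split (length-takeω (length F) _)
    where
    open ≡-Reasoning
    split : factor s i (length F) ++ takeω (length G) (λ j → s (i + (length F + j))) ≡ F ++ G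
    split = begin
      factor s i (length F) ++ takeω (length G) (λ j → s (i + (length F + j)))
                                        ≡⟨ takeω-+ (length F) (length G) _ ⟨
      factor s i (length F + length G)  ≡⟨ cong (factor s i) (length-++ F) ⟨
      factor s i (length (F ++ G))      ≡⟨ eq ⟩
      F ++ G                            ∎
  ... | F≡ , G≡ = F≡ , trans (takeω-cong (length G) (λ j → cong s (+-assoc i (length F) j))) G≡

  prefixω-++⁻ : ∀ {s : InfWord k} (F G : Word k) → IsPrefixω (F ++ G) s → IsPrefixω F s
  prefixω-++⁻ {s} F G h = proj₁ (factor-++⁻ s 0 F G h)

  record IsFactor (F : Word k) (s : InfWord k) : Set where
    constructor occurs-at
    field
      position : ℕ
      factor≡  : factor s position (length F) ≡ F

  prefix⇒factor : ∀ {w} {s : InfWord k} → IsPrefixω w s → IsFactor w s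
  prefix⇒factor h = occurs-at 0 h

  factor-prefix : ∀ {s : InfWord k} (F r : Word k) → IsFactor (F ++ r) s → IsFactor F s
  factor-prefix {s} F r (occurs-at i eq) = occurs-at i (proj₁ (factor-++⁻ s i F r eq))

  factor-suffix : ∀ {s : InfWord k} (l F : Word k) → IsFactor (l ++ F) s → IsFactor F s
  factor-suffix {s} l F (occurs-at i eq) = occurs-at (i + length l) (proj₂ (factor-++⁻ s i l F eq))

  factor-infix : ∀ {s : InfWord k} {F w : Word k} → IsFactor w s → IsInfix F w → IsFactor F s
  factor-infix {F = F} w-factor (l , r , refl) = factor-prefix F r (factor-suffix l (F ++ r) w-factor)

  factor-take : ∀ {s : InfWord k} n (V : Word k) → IsFactor V s → IsFactor (take n V) s
  factor-take {s} n V V-factor =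
    factor-prefix (take n V) (drop n V) (subst (λ w → IsFactor w s) (sym (take++drop≡id n V)) V-factor)

  All-takeω : ∀ {P : Fin k → Set} n (f : InfWord k) → All P (takeω n f) → ∀ p → p < n → P (f p)
  All-takeω (suc n) f (fp ∷ _)   zero    _         = fp
  All-takeω (suc n) f (_ ∷ rest) (suc p) (s≤s p<n) = All-takeω n (λ i → f (suc i)) rest p p<n

  third-letter : ∀ {s : InfWord k} → HasThreeLetters s → ∀ x y → Σ ℕ λ p → s p ≢ x × s p ≢ y
  third-letter {s} (i , j , l , i≢j , i≢l , j≢l) x y with classify (s i) | classify (s j) | classify (s l)
    where
    classify : ∀ c → (c ≡ x ⊎ c ≡ y) ⊎ (c ≢ x × c ≢ y)
    classify c with c ≟F x | c ≟F y
    ... | yes c≡x | _       = inj₁ (inj₁ c≡x)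
    ... | no _    | yes c≡y = inj₁ (inj₂ c≡y)
    ... | no c≢x  | no c≢y  = inj₂ (c≢x , c≢y)
  ... | inj₂ other | _          | _          = i , other
  ... | _          | inj₂ other | _          = j , other
  ... | _          | _          | inj₂ other = l , other
  ... | inj₁ (inj₁ ix) | inj₁ (inj₁ jx) | _ = ⊥-elim (i≢j (trans ix (sym jx)))
  ... | inj₁ (inj₂ iy) | inj₁ (inj₂ jy) | _ = ⊥-elim (i≢j (trans iy (sym jy)))
  ... | inj₁ (inj₁ ix) | _ | inj₁ (inj₁ lx) = ⊥-elim (i≢l (trans ix (sym lx)))
  ... | inj₁ (inj₂ iy) | _ | inj₁ (inj₂ ly) = ⊥-elim (i≢l (trans iy (sym ly)))
  ... | _ | inj₁ (inj₁ jx) | inj₁ (inj₁ lx) = ⊥-elim (j≢l (trans jx (sym lx)))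
  ... | _ | inj₁ (inj₂ jy) | inj₁ (inj₂ ly) = ⊥-elim (j≢l (trans jy (sym ly)))

  factor-balance : ∀ {s : InfWord k} → IsBalanced s → ∀ {F G : Word k} → IsFactor F s → IsFactor G s →
                   length F ≡ length G → ∀ b → count b F ≤ suc (count b G)
  factor-balance {s} bal {F} (occurs-at i F≡) (occurs-at j G≡) |F|≡|G| b =
    subst₂ (λ X Y → count b X ≤ suc (count b Y)) F≡ (trans (cong (factor s j) |F|≡|G|) G≡)
           (bal i j (length F) b)

  count-absent : ∀ {x} {w : Word k} → All (_≢ x) w → count x w ≡ 0
  count-absent {x} x∉w = cong length (filter-none (_≟F x) x∉w)

  count-sandwich : ∀ x (A : Word k) → 2 ≤ count x (x ∷ A ++ [ x ])
  count-sandwich x A rewrite filter-accept (_≟F x) {x} {A ++ [ x ]} refl =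
    s≤s (filter-some (_≟F x) (Any.++⁺ʳ A (here refl)))

  balanced-sandwich : ∀ {s : InfWord k} → IsBalanced s → ∀ {x d} (A B : Word k) →
                      IsFactor (x ∷ A ++ [ x ]) s → IsFactor (B ++ d ∷ B) s →
                      suc (length A) ≤ length B + length B → All (_≢ x) B → d ≢ x → ⊥
  balanced-sandwich bal {x} {d} A B xAx BdB A<2B x∉B d≢x = 2≰1 (begin
    2                      ≤⟨ count-sandwich x A ⟩
    count x F              ≤⟨ factor-balance bal xAx (factor-take n V BdB) (sym |G|≡n) x ⟩
    suc (count x (take n V)) ≡⟨ cong suc (count-absent (All.take⁺ n (All.++⁺ x∉B (d≢x ∷ x∉B)))) ⟩
    1                      ∎)
    where
    open Data.Nat.Properties.≤-Reasoning
    F = x ∷ A ++ [ x ]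
    V = B ++ d ∷ B
    n = length F
    2≰1 : ¬ 2 ≤ 1
    2≰1 (s≤s ())
    |G|≡n : length (take n V) ≡ n
    |G|≡n = trans (length-take n V) (m≤n⇒m⊓n≡m (begin
      suc (length (A ++ [ x ]))     ≡⟨ cong suc (trans (length-++ A) (+-comm (length A) 1)) ⟩
      suc (suc (length A))          ≤⟨ s≤s A<2B ⟩
      suc (length B + length B)     ≡⟨ +-suc (length B) (length B) ⟨
      length B + length (d ∷ B)     ≡⟨ length-++ B ⟨
      length V                      ∎))

below-suc : ∀ {P : ℕ → Set} {N} → (∀ i → i < N → P i) → P N → ∀ i → i < suc N → P i
below-suc below pN i i<1+N with m≤n⇒m<n∨m≡n (≤-pred i<1+N)
... | inj₁ i<N  = below i i<N
... | inj₂ refl = pN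

all-below-or-first : ∀ {P Q : ℕ → Set} → (∀ n → P n ⊎ Q n) → ∀ N →
                     (∀ i → i < N → P i) ⊎ (Σ ℕ λ m → (∀ i → i < m → P i) × Q m)
all-below-or-first dec zero = inj₁ (λ _ ())
all-below-or-first dec (suc N) with all-below-or-first dec N
... | inj₂ first = inj₂ first
... | inj₁ below with dec N
...   | inj₁ pN = inj₁ (below-suc below pN)
...   | inj₂ qN = inj₂ (N , below , qN)

-- The words Q j and W n r

module Blocks {k : ℕ} (a : Fin k) (ℓ : ℕ) (b : ℕ → Fin k) where

  Q : ℕ → Word k
  Q zero    = replicate ℓ a
  Q (suc j) = Q j ++ b j ∷ Q j

  W : ℕ → ℕ → Word k
  W n zero    = Q n
  W n (suc r) = W n r ++ b n ∷ Q n

  R : ℕ → ℕ → Word k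
  R n zero    = []
  R n (suc r) = R n r ++ b n ∷ Q n

  Unused : ℕ → Fin k → Set
  Unused m x = x ≢ a × (∀ j → j < m → b j ≢ x)

  Fresh : ℕ → Set
  Fresh m = Unused m (b m)

  Distinct : ℕ → Set
  Distinct m = ∀ i → i < m → Fresh i

  Distinct-≤ : ∀ {m m′} → m′ ≤ m → Distinct m → Distinct m′
  Distinct-≤ m′≤m distinct i i<m′ = distinct i (≤-trans i<m′ m′≤m)

  unused? : ∀ m x → Unused m x ⊎ (x ≡ a ⊎ Σ ℕ λ j → j < m × b j ≡ x)
  unused? m x with x ≟F a
  ... | yes x≡a = inj₂ (inj₁ x≡a)
  ... | no x≢a with anyUpTo? (λ j → b j ≟F x) m
  ...   | yes used = inj₂ (inj₂ used)
  ...   | no unused = inj₁ (x≢a , λ j j<m b≡x → unused (j , j<m , b≡x))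

  Q-palindrome : ∀ j → IsPalindrome (Q j)
  Q-palindrome zero    = reverse-replicate ℓ a
  Q-palindrome (suc j) = subst (λ v → IsPalindrome (Q j ++ b j ∷ v)) (Q-palindrome j)
                               (palindrome-sandwich (Q j) [ b j ] refl)

  Q-prefix : ∀ {i j} → i ≤ j → IsPrefix (Q i) (Q j)
  Q-prefix = prefix-chain Q (λ j → b j ∷ Q j , refl)

  W-prefix : ∀ n {r r′} → r ≤ r′ → IsPrefix (W n r) (W n r′)
  W-prefix n = prefix-chain (W n) (λ r → b n ∷ Q n , refl)

  Q-length : ∀ j → ℓ ≤ length (Q j)
  Q-length zero    = ≤-reflexive (sym (length-replicate ℓ))
  Q-length (suc j) = ≤-trans (Q-length j) (length-++-≤ˡ (Q j))

  W≡Q++R : ∀ n r → W n r ≡ Q n ++ R n r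
  W≡Q++R n zero    = sym (++-identityʳ (Q n))
  W≡Q++R n (suc r) = trans (cong (_++ b n ∷ Q n) (W≡Q++R n r)) (++-assoc (Q n) (R n r) (b n ∷ Q n))

  R-comm : ∀ n r → b n ∷ Q n ++ R n r ≡ R n r ++ b n ∷ Q n
  R-comm n zero    = ++-identityʳ (b n ∷ Q n)
  R-comm n (suc r) = trans (sym (++-assoc (b n ∷ Q n) (R n r) (b n ∷ Q n)))
                           (cong (_++ b n ∷ Q n) (R-comm n r))

  R-palindrome : ∀ n r → IsPalindrome (R n r ++ [ b n ])
  R-palindrome n zero    = refl
  R-palindrome n (suc r) = begin
    reverse ((R n r ++ c ∷ Q n) ++ [ c ])   ≡⟨ cong (λ v → reverse (v ++ [ c ])) (R-comm n r) ⟨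
    reverse (c ∷ (Q n ++ R n r) ++ [ c ])
      ≡⟨ cong (λ v → reverse (c ∷ v)) (++-assoc (Q n) (R n r) [ c ]) ⟩
    reverse ((c ∷ Q n) ++ y)                ≡⟨ reverse-++ (c ∷ Q n) y ⟩
    reverse y ++ reverse (c ∷ Q n)          ≡⟨ cong₂ _++_ (R-palindrome n r) (unfold-reverse c (Q n)) ⟩
    y ++ reverse (Q n) ++ [ c ]             ≡⟨ cong (λ v → y ++ v ++ [ c ]) (Q-palindrome n) ⟩
    (R n r ++ [ c ]) ++ Q n ++ [ c ]        ≡⟨ ++-assoc (R n r) [ c ] (Q n ++ [ c ]) ⟩
    R n r ++ c ∷ Q n ++ [ c ]               ≡⟨ ++-assoc (R n r) (c ∷ Q n) [ c ] ⟨
    (R n r ++ c ∷ Q n) ++ [ c ]             ∎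
    where
    open ≡-Reasoning
    c = b n
    y = R n r ++ [ c ]

  Unused-≤ : ∀ {m m′ x} → m′ ≤ m → Unused m x → Unused m′ x
  Unused-≤ m′≤m (x≢a , unused) = x≢a , λ j j<m′ → unused j (≤-trans j<m′ m′≤m)

  Q-avoids : ∀ {m x} → Unused m x → All (_≢ x) (Q m)
  Q-avoids {zero}  (x≢a , _)    = All.replicate⁺ ℓ (≢-sym x≢a)
  Q-avoids {suc m} unused@(_ , b≢x) = All.++⁺ rec (b≢x m ≤-refl ∷ rec)
    where
    rec : All (_≢ _) (Q m)
    rec = Q-avoids (Unused-≤ (n≤1+n m) unused)

  W-avoids : ∀ {n x} r → All (_≢ x) (Q n) → b n ≢ x → All (_≢ x) (W n r)
  W-avoids zero    x∉Q _   = x∉Q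
  W-avoids (suc r) x∉Q b≢x = All.++⁺ (W-avoids r x∉Q b≢x) (b≢x ∷ x∉Q)

  NoRun : Word k → Set
  NoRun w = ¬ IsInfix (replicate (suc ℓ) a) w

  noRun-join : ∀ {x v : Word k} {y} → y ≢ a → NoRun x → NoRun v → NoRun (x ++ y ∷ v)
  noRun-join y≢a x-ok v-ok run with infix-++-∷ (All.replicate⁺ (suc ℓ) (≢-sym y≢a)) run
  ... | inj₁ in-x = x-ok in-x
  ... | inj₂ in-v = v-ok in-v

  Q-noRun : ∀ m → (∀ i → i < m → b i ≢ a) → NoRun (Q m)
  Q-noRun zero    _     run =
    1+n≰n (subst₂ _≤_ (length-replicate (suc ℓ)) (length-replicate ℓ) (infix-length run))
  Q-noRun (suc m) b≢a = noRun-join (b≢a m ≤-refl) rec rec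
    where
    rec : NoRun (Q m)
    rec = Q-noRun m (λ i i<m → b≢a i (≤-trans i<m (n≤1+n m)))

  W-noRun : ∀ n r → (∀ i → i < suc n → b i ≢ a) → NoRun (W n r)
  W-noRun n r b≢a = go r
    where
    Q-ok : NoRun (Q n)
    Q-ok = Q-noRun n (λ i i<n → b≢a i (≤-trans i<n (n≤1+n n)))
    go : ∀ r → NoRun (W n r)
    go zero    = Q-ok
    go (suc r) = noRun-join (b≢a n ≤-refl) (go r) Q-ok

  toℕ-clamp : ∀ n t → toℕ (clamp n t) ≡ t ⊓ n
  toℕ-clamp zero    zero    = refl
  toℕ-clamp zero    (suc t) = refl
  toℕ-clamp (suc n) zero    = refl
  toℕ-clamp (suc n) (suc t) = cong suc (toℕ-clamp n t)

  letter : ∀ m → Fin (suc m) → Fin k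
  letter m zero    = a
  letter m (suc i) = b (toℕ i)

  distinct-injective : ∀ {m i j} → Distinct m → i < m → j < m → b i ≡ b j → i ≡ j
  distinct-injective {i = i} {j} distinct i<m j<m b≡ with <-cmp i j
  ... | tri< i<j _ _ = ⊥-elim (proj₂ (distinct j j<m) i i<j b≡)
  ... | tri≈ _ i≡j _ = i≡j
  ... | tri> _ _ j<i = ⊥-elim (proj₂ (distinct i i<m) j j<i (sym b≡))

  letter-injective : ∀ {m} → Distinct m → Injective _≡_ _≡_ (letter m)
  letter-injective distinct {zero}  {zero}  _  = refl
  letter-injective distinct {zero}  {suc j} eq = ⊥-elim (proj₁ (distinct (toℕ j) (toℕ<n j)) (sym eq))
  letter-injective distinct {suc i} {zero}  eq = ⊥-elim (proj₁ (distinct (toℕ i) (toℕ<n i)) eq)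
  letter-injective distinct {suc i} {suc j} eq =
    cong suc (toℕ-injective (distinct-injective distinct (toℕ<n i) (toℕ<n j) eq))

  ¬Distinct-k : ¬ Distinct k
  ¬Distinct-k distinct with pigeonhole (n<1+n k) (letter k)
  ... | i , j , i<j , eq = <-irrefl (cong toℕ (letter-injective distinct eq)) i<j

-- Directive sequences

module Directive {k : ℕ} {s Δ : InfWord k} (u : ℕ → Word k) (u0 : u 0 ≡ [])
                 (closure : ∀ n → IsPalClosure (u n ++ [ Δ n ]) (u (suc n)))
                 (prefix : ∀ n → IsPrefixω (u n) s) where

  u-palindrome : ∀ n → IsPalindrome (u n)
  u-palindrome zero    = subst IsPalindrome (sym u0) refl
  u-palindrome (suc n) = proj₁ (closure n)

  u-next : ∀ {n w p} → u n ++ [ Δ n ] ≡ w → IsPalClosure w p → u (suc n) ≡ p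
  u-next {n} refl = palClosure-unique (closure n)

  u-extends : ∀ n → IsPrefix (u n ++ [ Δ n ]) (u (suc n))
  u-extends n = proj₁ (proj₂ (closure n))

  u-prefix : ∀ {m n} → m ≤ n → IsPrefix (u m) (u n)
  u-prefix = prefix-chain u step
    where
    step : ∀ n → IsPrefix (u n) (u (suc n))
    step n with u-extends n
    ... | r , eq = Δ n ∷ r , trans (sym (++-assoc (u n) [ Δ n ] r)) eq

  u-length : ∀ n → n ≤ length (u n)
  u-length zero    = z≤n
  u-length (suc n) with u-extends n
  ... | r , ext≡ = begin
    suc n                          ≤⟨ s≤s (u-length n) ⟩
    suc (length (u n))             ≡⟨ trans (length-++ (u n)) (+-comm (length (u n)) 1) ⟨
    length (u n ++ [ Δ n ])        ≤⟨ length-++-≤ˡ (u n ++ [ Δ n ]) ⟩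
    length ((u n ++ [ Δ n ]) ++ r) ≡⟨ cong length ext≡ ⟩
    length (u (suc n))             ∎
    where open Data.Nat.Properties.≤-Reasoning

  u-factor : ∀ n → IsFactor (u n) s
  u-factor n = prefix⇒factor (prefix n)

  u-prefix-factor : ∀ {n w} → IsPrefix w (u n) → IsFactor w s
  u-prefix-factor {n} {w} (r , u≡) =
    prefix⇒factor (prefixω-++⁻ w r (subst (λ v → IsPrefixω v s) (sym u≡) (prefix n)))

  u-return-factor : ∀ {n p} → IsPrefix p (u n) → IsFactor (reverse p ++ [ Δ n ]) s
  u-return-factor {n} {p} p⊑u with palindrome-prefix⇒suffix (u-palindrome n) p⊑u | u-extends n
  ... | P , u≡ | r , ext≡ = factor-suffix P (reverse p ++ [ Δ n ]) (u-prefix-factor {suc n} (r , (begin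
    (P ++ reverse p ++ [ Δ n ]) ++ r  ≡⟨ cong (_++ r) (++-assoc P (reverse p) [ Δ n ]) ⟨
    ((P ++ reverse p) ++ [ Δ n ]) ++ r ≡⟨ cong (λ v → (v ++ [ Δ n ]) ++ r) u≡ ⟨
    (u n ++ [ Δ n ]) ++ r             ≡⟨ ext≡ ⟩
    u (suc n)                         ∎)))
    where open ≡-Reasoning

  u-avoids : ∀ {n x} → (∀ i → i < n → Δ i ≢ x) → All (_≢ x) (u n)
  u-avoids {zero}  _   = subst (All _) (sym u0) []
  u-avoids {suc n} Δ≢x = palClosure-All (closure n)
    (All.∷ʳ⁺ (u-avoids (λ i i<n → Δ≢x i (≤-trans i<n (n≤1+n n)))) (Δ≢x n ≤-refl))

  u-fresh : ∀ {n x} → All (_≢ x) (u n) → Δ n ≡ x → u (suc n) ≡ u n ++ x ∷ u n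
  u-fresh {n} {x} x∉u refl = u-next refl
    (subst (λ v → IsPalClosure (u n ++ [ x ]) (u n ++ x ∷ v)) (u-palindrome n)
           (palClosure-fresh (u n) [] x refl x∉u))

  fresh-letter-factor : ∀ {n x p} → All (_≢ x) (u n) → Δ n ≡ x → IsPrefix p (u n) →
                        IsFactor (reverse p ++ x ∷ p) s
  fresh-letter-factor {n} {x} {p} x∉u Δ≡x p⊑u@(r , u≡p++r)
    with palindrome-prefix⇒suffix (u-palindrome n) p⊑u
  ... | P , u≡ = factor-infix (u-factor (suc n)) (P , r , (begin
    P ++ (reverse p ++ x ∷ p) ++ r  ≡⟨ cong (P ++_) (++-assoc (reverse p) (x ∷ p) r) ⟩
    P ++ reverse p ++ x ∷ p ++ r    ≡⟨ ++-assoc P (reverse p) (x ∷ p ++ r) ⟨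
    (P ++ reverse p) ++ x ∷ p ++ r  ≡⟨ cong₂ (λ v w → v ++ x ∷ w) u≡ (sym u≡p++r) ⟨
    u n ++ x ∷ u n                   ≡⟨ u-fresh x∉u Δ≡x ⟨
    u (suc n)                        ∎))
    where open ≡-Reasoning

-- Balanced directive sequences beginning with a^ℓ

module BalancedDirective {k : ℕ} {s Δ : InfWord k} {a : Fin k} {ℓ : ℕ}
             (balanced : IsBalanced s) (three : HasThreeLetters s)
             (u : ℕ → Word k) (u0 : u 0 ≡ [])
             (closure : ∀ n → IsPalClosure (u n ++ [ Δ n ]) (u (suc n)))
             (prefix : ∀ n → IsPrefixω (u n) s)
             (ℓ≥2 : 2 ≤ ℓ) (Δ<ℓ : ∀ i → i < ℓ → Δ i ≡ a) (Δℓ≢a : Δ ℓ ≢ a) where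

  b : ℕ → Fin k
  b i = Δ (ℓ + i)

  open Directive {s = s} u u0 closure prefix
  open Blocks a ℓ b public

  b0≢a : b 0 ≢ a
  b0≢a = subst (_≢ a) (cong Δ (sym (+-identityʳ ℓ))) Δℓ≢a

  u-init : ∀ i → i ≤ ℓ → u i ≡ replicate i a
  u-init zero    _   = u0
  u-init (suc i) i<ℓ = u-next
    (trans (cong₂ (λ v x → v ++ [ x ]) (u-init i (<⇒≤ i<ℓ)) (Δ<ℓ i i<ℓ)) (replicate-snoc i a))
    (palClosure-self (reverse-replicate (suc i) a))

  u-Q : ∀ m → Distinct m → u (ℓ + m) ≡ Q m
  u-Q zero    _        = trans (cong u (+-identityʳ ℓ)) (u-init ℓ ≤-refl)
  u-Q (suc m) distinct = begin
    u (ℓ + suc m)                ≡⟨ cong u (+-suc ℓ m) ⟩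
    u (suc (ℓ + m))
      ≡⟨ u-fresh (subst (All (_≢ b m)) (sym previous) (Q-avoids (distinct m ≤-refl))) refl ⟩
    u (ℓ + m) ++ b m ∷ u (ℓ + m) ≡⟨ cong (λ v → v ++ b m ∷ v) previous ⟩
    Q (suc m)                    ∎
    where
    open ≡-Reasoning
    previous : u (ℓ + m) ≡ Q m
    previous = u-Q m (λ i i<m → distinct i (≤-trans i<m (n≤1+n m)))

  Q-doubling : ∀ j → suc (length (Q j)) ≤ length (Q j) + length (Q j)
  Q-doubling j = +-monoˡ-≤ (length (Q j)) (≤-trans (s≤s z≤n) (≤-trans ℓ≥2 (Q-length j)))

  W-step : ∀ {N n r} → u N ≡ W n r → Δ N ≡ b n → All (_≢ b n) (Q n) → u (suc N) ≡ W n (suc r)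
  W-step {N} {n} {r} u≡W Δ≡c c∉Q =
    trans (u-next input (palClosure-fresh (Q n) (R n r) c (R-palindrome n r) c∉Q)) output
    where
    open ≡-Reasoning
    c = b n
    input : u N ++ [ Δ N ] ≡ Q n ++ R n r ++ [ c ]
    input = trans (cong₂ (λ v x → v ++ [ x ]) (trans u≡W (W≡Q++R n r)) Δ≡c) (++-assoc (Q n) (R n r) [ c ])
    output : Q n ++ (R n r ++ [ c ]) ++ reverse (Q n) ≡ W n (suc r)
    output = begin
      Q n ++ (R n r ++ [ c ]) ++ reverse (Q n)
        ≡⟨ cong (λ v → Q n ++ (R n r ++ [ c ]) ++ v) (Q-palindrome n) ⟩
      Q n ++ (R n r ++ [ c ]) ++ Q n           ≡⟨ cong (Q n ++_) (++-assoc (R n r) [ c ] (Q n)) ⟩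
      Q n ++ R n r ++ c ∷ Q n                  ≡⟨ ++-assoc (Q n) (R n r) (c ∷ Q n) ⟨
      (Q n ++ R n r) ++ c ∷ Q n                ≡⟨ cong (_++ c ∷ Q n) (W≡Q++R n r) ⟨
      W n r ++ c ∷ Q n                         ∎

  isolated-letter : ∀ p → s p ≢ a → IsFactor (replicate ℓ a ++ s p ∷ replicate ℓ a) s
  isolated-letter p d≢a with all-below-or-first (λ i → swap (toSum (Δ i ≟F s p))) (suc p)
  ... | inj₁ Δ≢d = ⊥-elim (All-takeω (length (u (suc p))) s
                            (subst (All (_≢ s p)) (sym (prefix (suc p))) (u-avoids Δ≢d))
                            p (u-length (suc p)) refl)
  ... | inj₂ (n , Δ≢d , Δ≡d) =
    subst (λ v → IsFactor (v ++ s p ∷ replicate ℓ a) s) (reverse-replicate ℓ a)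
          (fresh-letter-factor (u-avoids Δ≢d) Δ≡d
            (subst (λ v → IsPrefix v (u n)) (u-init ℓ ≤-refl) (u-prefix ℓ≤n)))
    where
    ℓ≤n : ℓ ≤ n
    ℓ≤n with ℓ ≤? n
    ... | yes ℓ≤n = ℓ≤n
    ... | no ℓ≰n = ⊥-elim (d≢a (trans (sym Δ≡d) (Δ<ℓ n (≰⇒> ℓ≰n))))

  no-return-to-a : ∀ {N} → IsPrefix (Q 1) (u N) → NoRun (u N) → Δ N ≢ a
  no-return-to-a {N} Q1⊑u no-run Δ≡a
    with palindrome-prefix⇒suffix (u-palindrome N) Q1⊑u | third-letter three a (b 0)
  ... | P , u≡ | p , d≢a , d≢e =
    balanced-sandwich balanced A (replicate ℓ a) eAe (isolated-letter p d≢a) A<2ℓ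
                      (All.replicate⁺ ℓ (≢-sym b0≢a)) d≢e
    where
    open ≡-Reasoning
    e = b 0
    A = replicate (suc ℓ) a
    P′ = P ++ replicate ℓ a
    u≡P′ : u N ≡ P′ ++ e ∷ replicate ℓ a
    u≡P′ = trans u≡ (trans (cong (P ++_) (Q-palindrome 1)) (sym (++-assoc P (replicate ℓ a) _)))
    input : u N ++ [ Δ N ] ≡ (P′ ++ [ e ]) ++ A
    input = begin
      u N ++ [ Δ N ]                      ≡⟨ cong₂ (λ v x → v ++ [ x ]) u≡P′ Δ≡a ⟩
      (P′ ++ e ∷ replicate ℓ a) ++ [ a ]  ≡⟨ ++-assoc P′ (e ∷ replicate ℓ a) [ a ] ⟩
      P′ ++ e ∷ replicate ℓ a ++ [ a ]    ≡⟨ cong (λ v → P′ ++ e ∷ v) (replicate-snoc ℓ a) ⟩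
      P′ ++ e ∷ A                         ≡⟨ ++-assoc P′ [ e ] A ⟨
      (P′ ++ [ e ]) ++ A                  ∎
    eAe : IsFactor (e ∷ A ++ [ e ]) s
    eAe = factor-infix (u-factor (suc N)) (P′ , reverse P′ , (begin
      P′ ++ e ∷ (A ++ [ e ]) ++ reverse P′
        ≡⟨ cong (λ v → P′ ++ e ∷ v) (++-assoc A [ e ] (reverse P′)) ⟩
      P′ ++ e ∷ A ++ e ∷ reverse P′
        ≡⟨ ++-assoc P′ [ e ] (A ++ e ∷ reverse P′) ⟨
      (P′ ++ [ e ]) ++ A ++ e ∷ reverse P′
        ≡⟨ cong (λ v → (P′ ++ [ e ]) ++ A ++ v) (reverse-++ P′ [ e ]) ⟨
      (P′ ++ [ e ]) ++ A ++ reverse (P′ ++ [ e ])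
        ≡⟨ u-next input (palClosure-run P′ ℓ b0≢a (subst NoRun u≡P′ no-run)) ⟨
      u (suc N)
        ∎))
    -- The one place where ℓ ≥ 2 (not just ℓ ≥ 1) is needed: e a^(ℓ+1) e must fit into a^ℓ d a^ℓ.
    A<2ℓ : suc (length A) ≤ length (replicate ℓ a) + length (replicate ℓ a)
    A<2ℓ = subst₂ (λ x y → suc x ≤ y + y) (sym (length-replicate (suc ℓ))) (sym (length-replicate ℓ))
                  (+-monoˡ-≤ ℓ ℓ≥2)

  no-early-repeat : ∀ {N j} → Distinct (suc (suc j)) → IsPrefix (Q (suc (suc j))) (u N) → Δ N ≢ b j
  no-early-repeat {N} {j} distinct Q⊑u Δ≡x =
    balanced-sandwich balanced A A xAx AdA (Q-doubling j) (Q-avoids (distinct j (s≤s (n≤1+n j))))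
                      (≢-sym (proj₂ (distinct (suc j) ≤-refl) j ≤-refl))
    where
    open ≡-Reasoning
    A = Q j
    x = b j
    d = b (suc j)
    xAx : IsFactor (x ∷ A ++ [ x ]) s
    xAx = factor-suffix A (x ∷ A ++ [ x ])
      (subst (λ v → IsFactor v s) (trans (cong₂ (λ v y → v ++ [ y ]) (Q-palindrome (suc j)) Δ≡x)
                                         (++-assoc A (x ∷ A) [ x ]))
             (u-return-factor (prefix-trans (Q-prefix (n≤1+n (suc j))) Q⊑u)))
    AdA : IsFactor (A ++ d ∷ A) s
    AdA = factor-infix (u-prefix-factor Q⊑u) (A ++ [ x ] , x ∷ A , (begin
      (A ++ [ x ]) ++ (A ++ d ∷ A) ++ x ∷ A ≡⟨ ++-assoc A [ x ] _ ⟩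
      A ++ x ∷ (A ++ d ∷ A) ++ x ∷ A
                                            ≡⟨ cong (λ v → A ++ x ∷ v) (++-assoc A (d ∷ A) (x ∷ A)) ⟩
      A ++ x ∷ A ++ d ∷ A ++ x ∷ A          ≡⟨ ++-assoc A (x ∷ A) (d ∷ A ++ x ∷ A) ⟨
      Q (suc (suc j))                       ∎))

  no-new-letter : ∀ {N n x} → IsPrefix (W n 2) (u N) → All (_≢ x) (u N) → b n ≢ x →
                  All (_≢ b n) (Q n) → Δ N ≢ x
  no-new-letter {N} {n} {x} W⊑u x∉u c≢x c∉Q Δ≡x =
    balanced-sandwich balanced A A cAc AxA (Q-doubling n) c∉Q (≢-sym c≢x)
    where
    open ≡-Reasoning
    A = Q n
    c = b n
    cAc : IsFactor (c ∷ A ++ [ c ]) s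
    cAc = factor-infix (u-prefix-factor W⊑u) (A , A , (begin
      A ++ c ∷ (A ++ [ c ]) ++ A ≡⟨ cong (λ v → A ++ c ∷ v) (++-assoc A [ c ] A) ⟩
      A ++ c ∷ A ++ c ∷ A        ≡⟨ ++-assoc A (c ∷ A) (c ∷ A) ⟨
      W n 2                      ∎))
    AxA : IsFactor (A ++ x ∷ A) s
    AxA = subst (λ v → IsFactor (v ++ x ∷ A) s) (Q-palindrome n)
                (fresh-letter-factor x∉u Δ≡x (prefix-trans (W-prefix n {0} {2} z≤n) W⊑u))

  distinct⇒b≢a : ∀ m → Distinct m → b m ≢ a
  distinct⇒b≢a zero    _        = b0≢a
  distinct⇒b≢a (suc m) distinct =
    no-return-to-a (subst (IsPrefix (Q 1)) (sym u≡Q) (Q-prefix (s≤s z≤n)))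
                   (subst NoRun (sym u≡Q) (Q-noRun (suc m) (λ i i<m → proj₁ (distinct i i<m))))
    where
    u≡Q : u (ℓ + suc m) ≡ Q (suc m)
    u≡Q = u-Q (suc m) distinct

  distinct⇒b≢earlier : ∀ {m j} → Distinct m → suc j < m → b m ≢ b j
  distinct⇒b≢earlier {m} {j} distinct 1+j<m =
    no-early-repeat (Distinct-≤ 1+j<m distinct)
                    (subst (IsPrefix (Q (suc (suc j)))) (sym (u-Q m distinct)) (Q-prefix 1+j<m))

  first-repeat : Σ ℕ λ n → Distinct (suc n) × b (suc n) ≡ b n
  first-repeat with all-below-or-first (λ m → unused? m (b m)) k
  ... | inj₁ distinct                            = ⊥-elim (¬Distinct-k distinct)
  ... | inj₂ (m , distinct , inj₁ b≡a)            = ⊥-elim (distinct⇒b≢a m distinct b≡a)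
  ... | inj₂ (m , distinct , inj₂ (j , j<m , b≡)) with m≤n⇒m<n∨m≡n j<m
  ...   | inj₁ 1+j<m = ⊥-elim (distinct⇒b≢earlier distinct 1+j<m (sym b≡))
  ...   | inj₂ refl  = j , distinct , sym b≡

  module Repetition (n : ℕ) (distinct : Distinct (suc n)) (repeat : b (suc n) ≡ b n) where

    c∉Q : All (_≢ b n) (Q n)
    c∉Q = Q-avoids (distinct n ≤-refl)

    W-prefix-u : ∀ {N} r {r′} → u N ≡ W n r → r′ ≤ r → IsPrefix (W n r′) (u N)
    W-prefix-u r u≡W r′≤r = subst (IsPrefix _) (sym u≡W) (W-prefix n r′≤r)

    Q-prefix-u : ∀ {N} r {i} → u N ≡ W n (suc r) → i ≤ suc n → IsPrefix (Q i) (u N)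
    Q-prefix-u r u≡W i≤1+n = prefix-trans (Q-prefix i≤1+n) (W-prefix-u (suc r) {1} u≡W (s≤s z≤n))

    next-letter-forced : ∀ r → u (ℓ + (suc (suc r) + n)) ≡ W n (suc (suc r)) → b (suc (suc r) + n) ≡ b n
    next-letter-forced r u≡W with unused? (suc n) (b (suc (suc r) + n))
    ... | inj₁ unused@(_ , b≢x) = ⊥-elim (no-new-letter
            (W-prefix-u (suc (suc r)) {2} u≡W (s≤s (s≤s z≤n)))
            (subst (All _) (sym u≡W)
                   (W-avoids (suc (suc r)) (Q-avoids (Unused-≤ (n≤1+n n) unused)) (b≢x n ≤-refl)))
            (b≢x n ≤-refl) c∉Q refl)
    ... | inj₂ (inj₁ x≡a) = ⊥-elim (no-return-to-a (Q-prefix-u (suc r) u≡W (s≤s z≤n))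
            (subst NoRun (sym u≡W) (W-noRun n (suc (suc r)) (λ i i<1+n → proj₁ (distinct i i<1+n)))) x≡a)
    ... | inj₂ (inj₂ (j , j<1+n , bj≡x)) with m≤n⇒m<n∨m≡n (≤-pred j<1+n)
    ...   | inj₂ refl = sym bj≡x
    ...   | inj₁ j<n  = ⊥-elim (no-early-repeat (Distinct-≤ (s≤s j<n) distinct)
                                                (Q-prefix-u (suc r) u≡W (s≤s j<n)) (sym bj≡x))

    next-letter : ∀ r → u (ℓ + (suc r + n)) ≡ W n (suc r) → b (suc r + n) ≡ b n
    next-letter zero    _ = repeat
    next-letter (suc r)   = next-letter-forced r

    periodic : ∀ r → u (ℓ + (r + n)) ≡ W n r × b (r + n) ≡ b n
    periodic zero    = u-Q n (Distinct-≤ (n≤1+n n) distinct) , refl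
    periodic (suc r) = u≡W , next-letter r u≡W
      where
      u≡W : u (ℓ + (suc r + n)) ≡ W n (suc r)
      u≡W = trans (cong u (+-suc ℓ (r + n))) (W-step {r = r} (proj₁ (periodic r)) (proj₂ (periodic r)) c∉Q)

    eventually-constant : ∀ t → n ≤ t → b t ≡ b n
    eventually-constant t n≤t = subst (λ i → b i ≡ b n) (m∸n+n≡m n≤t) (proj₂ (periodic (t ∸ n)))

    b-clamped : ∀ t → b t ≡ letter (suc n) (suc (clamp n t))
    b-clamped t with ≤-total t n
    ... | inj₁ t≤n = cong b (sym (trans (toℕ-clamp n t) (m≤n⇒m⊓n≡m t≤n)))
    ... | inj₂ n≤t = trans (eventually-constant t n≤t)
                           (cong b (sym (trans (toℕ-clamp n t) (m≥n⇒m⊓n≡n n≤t))))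

proposition3p6 : (k : ℕ) (s Δ : InfWord k) (a : Fin k) (ℓ : ℕ) →
    IsBalanced s → IsStandardEpisturmian s → HasThreeLetters s →
    IsDirective Δ s → 2 ≤ ℓ → (∀ i → i < ℓ → Δ i ≡ a) → Δ ℓ ≢ a →
    Σ ℕ λ n → Σ (Fin (2 + n) → Fin k) λ c →
      Injective _≡_ _≡_ c × c zero ≡ a ×
      (∀ i → i < ℓ → Δ i ≡ c zero) ×
      (∀ t → Δ (ℓ + t) ≡ c (suc (clamp n t)))
proposition3p6 k s Δ a ℓ balanced _ three (u , u0 , closure , prefix) ℓ≥2 Δ<ℓ Δℓ≢a =
  let n , distinct , repeat = first-repeat in
  n , letter (suc n) , letter-injective distinct , refl , Δ<ℓ , Repetition.b-clamped n distinct repeat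
  where open BalancedDirective balanced three u u0 closure prefix ℓ≥2 Δ<ℓ Δℓ≢a
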